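{- $Q_{U(\emptyset,5)} \geq \frac{3}{2}$.
   Context: For a nonzero integer $N$, $\mathrm{rad}(N)$ denotes the largest square-free positive divisor of $N$. For $a = (a_1,\ldots,a_n) \in \mathbb{Z}^n$ with all $a_i \neq 0$, the quality of $a$ is $q(a) = \frac{\log(\max\{|a_1|,\ldots,|a_n|\})}{\log \mathrm{rad}(a_1 \cdots a_n)}$. For a set $A$ of such $n$-tuples, $Q_A$ denotes the limit superior of $q(a)$ over $a \in A$ (i.e. $\inf_{S \subseteq A \text{ finite}} \sup_{a \in A \setminus S} q(a)$). $U(\emptyset,5)$ is the set of all $(a_1,\ldots,a_5) \in \mathbb{Z}^5$ such that: (i) $\gcd(a_i,a_j) = 1$ for all $1 \leq i < j \leq 5$; (ii) $a_1 + \cdots + a_5 = 0$; (iii) there are no $b_1,\ldots,b_5 \in \{ -1,0,1\}$ and indices $i,j$ with $b_i = 0$, $b_j = 1$ and $\sum_{k=1}^5 b_k a_k = 0$. -}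

module Defs where

open import Data.Nat as ℕ using (ℕ; _⊔_; _≤_; _<_)
open import Data.Nat.Divisibility using (_∣_)
open import Data.Integer as ℤ using (ℤ; +_; -_; ∣_∣)
open import Data.Integer.GCD using (gcd)
open import Data.Fin using (Fin)
open import Data.Vec using (Vec; lookup; foldr; map; zipWith)
open import Data.Product using (Σ; ∃; ∃-syntax; _×_)
open import Relation.Binary.PropositionalEquality using (_≡_; _≢_)
open import Relation.Nullary using (¬_)

SquareFree : ℕ → Set
SquareFree r = (0 < r) × (∀ d → d ℕ.* d ∣ r → d ≡ 1)

IsRad : ℕ → ℕ → Set
IsRad N r = SquareFree r × (r ∣ N) × (∀ d → SquareFree d → d ∣ N → d ≤ r)

maxAbs : ∀ {n} → Vec ℤ n → ℕ
maxAbs a = foldr _ _⊔_ 0 (map ∣_∣ a)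

prodℤ : ∀ {n} → Vec ℤ n → ℤ
prodℤ a = foldr _ ℤ._*_ (+ 1) a

sumℤ : ∀ {n} → Vec ℤ n → ℤ
sumℤ a = foldr _ ℤ._+_ (+ 0) a

data Sgn : Set where
  neg zer pos : Sgn

sgnℤ : Sgn → ℤ
sgnℤ neg = - (+ 1)
sgnℤ zer = + 0
sgnℤ pos = + 1

signedSum : ∀ {n} → Vec Sgn n → Vec ℤ n → ℤ
signedSum b a = sumℤ (zipWith (λ s x → sgnℤ s ℤ.* x) b a)

InU5 : Vec ℤ 5 → Set
InU5 a =
  (∀ (i j : Fin 5) → i ≢ j → gcd (lookup a i) (lookup a j) ≡ + 1)
  × (sumℤ a ≡ + 0)
  × ¬ (Σ (Vec Sgn 5) λ b →
         (∃[ i ] lookup b i ≡ zer) × (∃[ j ] lookup b j ≡ pos) × (signedSum b a ≡ + 0))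

-- q(a) ≥ u / v  (v > 0), i.e. log M / log rad ≥ u/v  ⇔  M^v ≥ rad^u
QualityAtLeast : ∀ {n} → Vec ℤ n → ℕ → ℕ → Set
QualityAtLeast a u v =
  ∃[ r ] IsRad ∣ prodℤ a ∣ r × (r ℕ.^ u ≤ maxAbs a ℕ.^ v)

{-# OPTIONS --safe #-}
-- Take w ≡ 11 (mod 210) with w + 1 = 12 · 4096 ^ m. The quintuple
-- a = ((w + 2)³, − w³, − 6 (w + 1)², 5, − 7) sums to zero and is pairwise coprime, and
-- since w + 1 has no prime factors besides 2 and 3, rad(a₁ ⋯ a₅) divides 210 · w · (w + 2).
-- As max |aᵢ| = (w + 2)³, the quality of a tends to 3/2. Every entry is a polynomial in w
-- with small coefficients, so a signed subsum vanishing at a large w vanishes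
-- coefficientwise, and a check of the 3⁵ sign vectors shows that this only happens for the
-- trivial subsums.
module Submission where

open import Defs
open import Data.Nat as ℕ using (ℕ; zero; suc; _+_; _*_; _^_; _≤_; _<_; _⊔_; z≤n; s≤s; NonZero; >-nonZero)
open import Data.Nat.Properties
open import Data.Nat.Divisibility
open import Data.Nat.ListAction using (product)
open import Data.Nat.ListAction.Properties using (product≢0)
open import Data.Nat.Coprimality as Coprime
  using (Coprime; coprime?; coprime-+; coprime-divisor; 1-coprimeTo; coprime⇒gcd≡1)
open import Data.Nat.GCD as GCD using (gcd[m,n]∣m; gcd[m,n]∣n; gcd-greatest)
import Data.Nat.Tactic.RingSolver as ℕ-Solver
open import Data.Integer as ℤ using (ℤ; +_; -_; ∣_∣; 0ℤ)
import Data.Integer.Properties as ℤ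
open import Data.Integer.GCD using (gcd)
open import Data.Integer.Tactic.RingSolver using (solve-∀)
open import Data.Fin using (zero; suc)
open import Data.Fin.Properties using (any?)
open import Data.Vec as Vec using (Vec; []; _∷_; lookup; replicate; zipWith; toList)
open import Data.Vec.Properties using (lookup-map)
import Data.Vec.Relation.Unary.All as VecAll
open import Data.Vec.Relation.Unary.All.Properties using (lookup⁺)
open import Data.List as List using (List; []; _∷_)
open import Data.List.Relation.Unary.All as All using (All; []; _∷_; all?)
open import Data.List.Relation.Unary.All.Properties using (map⁺; map⁻)
open import Data.List.Relation.Unary.Any using (here; there)
open import Data.List.Membership.Propositional using (_∉_)
open import Data.Product using (Σ; ∃; ∃-syntax; _×_; _,_)
open import Data.Sum using (inj₁; inj₂)
open import Function using (_∘_; case_of_)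
open import Relation.Nullary using (Dec; yes; no; ¬_; ¬?; contradiction)
open import Relation.Nullary.Decidable using (map′; _×-dec_; _→-dec_; from-yes)
open import Relation.Unary using (Decidable)
open import Relation.Binary using (Rel; Symmetric; DecidableEquality)
open import Relation.Binary.PropositionalEquality

private
  variable
    m n k r d : ℕ

coprime-∣ˡ : d ∣ m → Coprime m n → Coprime d n
coprime-∣ˡ d∣m c (i∣d , i∣n) = c (∣-trans i∣d d∣m , i∣n)

coprime-∣ʳ : d ∣ n → Coprime m n → Coprime m d
coprime-∣ʳ d∣n = Coprime.sym ∘ coprime-∣ˡ d∣n ∘ Coprime.sym

coprime-*ʳ : Coprime m n → Coprime m k → Coprime m (n * k)
coprime-*ʳ m⊥n m⊥k (i∣m , i∣nk) = m⊥k (i∣m , coprime-divisor (coprime-∣ˡ i∣m m⊥n) i∣nk)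

coprime-^ʳ : ∀ k → Coprime m n → Coprime m (n ^ k)
coprime-^ʳ zero    m⊥n = Coprime.sym (1-coprimeTo _)
coprime-^ʳ (suc k) m⊥n = coprime-*ʳ m⊥n (coprime-^ʳ k m⊥n)

coprime-^ˡ : ∀ k → Coprime m n → Coprime (m ^ k) n
coprime-^ˡ k = Coprime.sym ∘ coprime-^ʳ k ∘ Coprime.sym

coprime-+ˡ : Coprime m n → Coprime (m + n) n
coprime-+ˡ {m} {n} m⊥n = subst (λ k → Coprime k n) (+-comm n m) (coprime-+ m⊥n)

coprime-+-* : ∀ k → Coprime r m → Coprime (r + k * m) m
coprime-+-* {r} {m} k r⊥m {i} (i∣r+km , i∣m) =
  r⊥m (∣m+n∣m⇒∣n (subst (i ∣_) (+-comm r (k * m)) i∣r+km) (∣n⇒∣m*n k i∣m) , i∣m)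

squareFree-1 : SquareFree 1
squareFree-1 = s≤s z≤n , λ d dd∣1 → m*n≡1⇒n≡1 d d (∣1⇒≡1 dd∣1)

squareFree? : Decidable SquareFree
squareFree? zero        = no λ ()
squareFree? r@(suc _) =
  map′ (λ f → s≤s z≤n , λ d dd∣r → f (s≤s (root≤ d (∣⇒≤ dd∣r))) dd∣r)
       (λ (_ , f) {d} _ → f d)
       (allUpTo? (λ d → d * d ∣? r →-dec d ℕ.≟ 1) (suc r))
  where
  root≤ : ∀ d → d * d ≤ r → d ≤ r
  root≤ zero    _     = z≤n
  root≤ (suc d) dd≤r = ≤-trans (m≤m*n (suc d) (suc d)) dd≤r

squareFree-∣^⇒∣ : ∀ k → SquareFree r → r ∣ n ^ k → r ∣ n
squareFree-∣^⇒∣ {r} {n} k (_ , sqf) r∣nᵏ with gcd[m,n]∣m r n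
... | divides h r≡h*g = subst (_∣ n) (sym r≡g) (gcd[m,n]∣n r n)
  where
  g = GCD.gcd r n
  h∣r : h ∣ r
  h∣r = subst (h ∣_) (sym r≡h*g) (m∣m*n g)
  -- a common divisor e of h and n also divides g, so e * e ∣ h * g = r
  h⊥n : Coprime h n
  h⊥n {e} (e∣h , e∣n) =
    sqf e (subst (e * e ∣_) (sym r≡h*g) (*-pres-∣ e∣h (gcd-greatest (∣-trans e∣h h∣r) e∣n)))
  h≡1 : h ≡ 1
  h≡1 = ∣1⇒≡1 (coprime-divisor (coprime-^ʳ k h⊥n)
                 (subst (h ∣_) (sym (*-identityʳ (n ^ k))) (∣-trans h∣r r∣nᵏ)))
  r≡g : r ≡ g
  r≡g = trans r≡h*g (trans (cong (_* g) h≡1) (*-identityˡ g))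

greatest-≤ : {P : ℕ → Set} → Decidable P → P 1 →
             ∀ n → ∃[ d ] P d × (∀ {e} → e ≤ n → P e → e ≤ d)
greatest-≤ P? p₁ zero = 1 , p₁ , λ { z≤n _ → z≤n }
greatest-≤ P? p₁ (suc n) with P? (suc n) | greatest-≤ P? p₁ n
... | yes p | _ = suc n , p , λ e≤ _ → e≤
... | no ¬p | d , pd , max = d , pd , λ e≤ pe → case m≤n⇒m<n∨m≡n e≤ of λ where
  (inj₁ e<) → max (≤-pred e<) pe
  (inj₂ refl) → contradiction pe ¬p

rad-exists : ∀ N .{{_ : NonZero N}} → ∃ (IsRad N)
rad-exists N with greatest-≤ (λ d → squareFree? d ×-dec d ∣? N) (squareFree-1 , 1∣ N) N
... | r , (sqf , r∣N) , max = r , sqf , r∣N , λ d sqf-d d∣N → max (∣⇒≤ d∣N) (sqf-d , d∣N)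

DividesPowerOf : ℕ → ℕ → Set
DividesPowerOf m n = ∃[ k ] n ∣ m ^ k

∣⇒dividesPowerOf : n ∣ m → DividesPowerOf m n
∣⇒dividesPowerOf {n} {m} n∣m = 1 , subst (n ∣_) (sym (*-identityʳ m)) n∣m

dividesPowerOf-* : DividesPowerOf m n → DividesPowerOf m k → DividesPowerOf m (n * k)
dividesPowerOf-* {m} {n} {k} (i , n∣mⁱ) (j , k∣mʲ) =
  i + j , subst (n * k ∣_) (sym (^-distribˡ-+-* m i j)) (*-pres-∣ n∣mⁱ k∣mʲ)

dividesPowerOf-^ : ∀ k → DividesPowerOf m n → DividesPowerOf m (n ^ k)
dividesPowerOf-^ zero    _ = 0 , ∣-refl
dividesPowerOf-^ (suc k) p = dividesPowerOf-* p (dividesPowerOf-^ k p)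

dividesPowerOf-trans : DividesPowerOf m n → DividesPowerOf k m → DividesPowerOf k n
dividesPowerOf-trans (i , n∣mⁱ) p with dividesPowerOf-^ i p
... | j , mⁱ∣kʲ = j , ∣-trans n∣mⁱ mⁱ∣kʲ

dividesPowerOf-product : ∀ {ns} → All (DividesPowerOf m) ns → DividesPowerOf m (product ns)
dividesPowerOf-product []       = 0 , ∣-refl
dividesPowerOf-product (p ∷ ps) = dividesPowerOf-* p (dividesPowerOf-product ps)

rad≤ : ∀ {N r R} .{{_ : NonZero R}} → IsRad N r → DividesPowerOf R N → r ≤ R
rad≤ (sqf , r∣N , _) (k , N∣Rᵏ) = ∣⇒≤ (squareFree-∣^⇒∣ k sqf (∣-trans r∣N N∣Rᵏ))

^-distribʳ-* : ∀ m n k → (m * n) ^ k ≡ m ^ k * n ^ k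
^-distribʳ-* m n zero    = refl
^-distribʳ-* m n (suc k) =
  trans (cong (m * n *_) (^-distribʳ-* m n k)) ([m*n]*[o*p]≡[m*o]*[n*p] m n (m ^ k) (n ^ k))

-- Numeric factors such as c = 210 are kept on the right of products: unification unfolds
-- 210 * n into 210 summands.
quality-bound : ∀ {r c Y u v} .{{_ : NonZero Y}} →
                r ≤ Y ^ 2 * c → c ^ u ≤ Y → 2 * u < 3 * v → r ^ u ≤ (Y ^ 3) ^ v
quality-bound {r} {c} {Y} {u} {v} r≤Y²c cᵘ≤Y 2u<3v = begin
  r ^ u               ≤⟨ ^-monoˡ-≤ u r≤Y²c ⟩
  (Y ^ 2 * c) ^ u     ≡⟨ ^-distribʳ-* (Y ^ 2) c u ⟩
  (Y ^ 2) ^ u * c ^ u ≤⟨ *-monoʳ-≤ ((Y ^ 2) ^ u) cᵘ≤Y ⟩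
  (Y ^ 2) ^ u * Y     ≡⟨ *-comm _ Y ⟩
  Y * (Y ^ 2) ^ u     ≡⟨ cong (Y *_) (^-*-assoc Y 2 u) ⟩
  Y ^ suc (2 * u)     ≤⟨ ^-monoʳ-≤ Y 2u<3v ⟩
  Y ^ (3 * v)         ≡⟨ ^-*-assoc Y 3 v ⟨
  (Y ^ 3) ^ v         ∎
  where open ≤-Reasoning

abs-prodℤ : ∀ {n} (a : Vec ℤ n) → ∣ prodℤ a ∣ ≡ product (toList (Vec.map ∣_∣ a))
abs-prodℤ []      = refl
abs-prodℤ (x ∷ a) = trans (ℤ.abs-* x (prodℤ a)) (cong (∣ x ∣ *_) (abs-prodℤ a))

data AllPairs {A : Set} (R : Rel A _) : ∀ {n} → Vec A n → Set where
  []  : AllPairs R []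
  _∷_ : ∀ {n x} {xs : Vec A n} → VecAll.All (R x) xs → AllPairs R xs → AllPairs R (x ∷ xs)

allPairs-lookup : ∀ {A : Set} {R : Rel A _} {n} {xs : Vec A n} → Symmetric R →
                  AllPairs R xs → ∀ i j → i ≢ j → R (lookup xs i) (lookup xs j)
allPairs-lookup sym (_  ∷ _)  zero    zero    i≢j = contradiction refl i≢j
allPairs-lookup sym (Rx ∷ _)  zero    (suc j) _   = lookup⁺ Rx j
allPairs-lookup sym (Rx ∷ _)  (suc i) zero    _   = sym (lookup⁺ Rx i)
allPairs-lookup sym (_  ∷ Rs) (suc i) (suc j) i≢j = allPairs-lookup sym Rs i j (i≢j ∘ cong suc)

gcd≡1 : ∀ {n} (a : Vec ℤ n) → AllPairs Coprime (Vec.map ∣_∣ a) →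
        ∀ i j → i ≢ j → gcd (lookup a i) (lookup a j) ≡ + 1
gcd≡1 a cop i j i≢j = cong +_ (coprime⇒gcd≡1
  (subst₂ Coprime (lookup-map i ∣_∣ a) (lookup-map j ∣_∣ a) (allPairs-lookup Coprime.sym cop i j i≢j)))

sumAbs : ∀ {n} → Vec ℤ n → ℕ
sumAbs c = Vec.sum (Vec.map ∣_∣ c)

∣sgnℤ∣≤1 : ∀ s → ∣ sgnℤ s ∣ ≤ 1
∣sgnℤ∣≤1 neg = ≤-refl
∣sgnℤ∣≤1 zer = z≤n
∣sgnℤ∣≤1 pos = ≤-refl

∣signedSum∣≤sumAbs : ∀ {n} (b : Vec Sgn n) c → ∣ signedSum b c ∣ ≤ sumAbs c
∣signedSum∣≤sumAbs []      []      = z≤n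
∣signedSum∣≤sumAbs (s ∷ b) (x ∷ c) = begin
  ∣ sgnℤ s ℤ.* x ℤ.+ signedSum b c ∣   ≤⟨ ℤ.∣i+j∣≤∣i∣+∣j∣ (sgnℤ s ℤ.* x) _ ⟩
  ∣ sgnℤ s ℤ.* x ∣ + ∣ signedSum b c ∣ ≡⟨ cong (_+ _) (ℤ.abs-* (sgnℤ s) x) ⟩
  ∣ sgnℤ s ∣ * ∣ x ∣ + ∣ signedSum b c ∣
    ≤⟨ +-mono-≤ (*-monoˡ-≤ ∣ x ∣ (∣sgnℤ∣≤1 s)) (∣signedSum∣≤sumAbs b c) ⟩
  1 * ∣ x ∣ + sumAbs c                 ≡⟨ cong (_+ sumAbs c) (*-identityˡ ∣ x ∣) ⟩
  ∣ x ∣ + sumAbs c                     ∎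
  where open ≤-Reasoning

sumℤ≡signedSum : ∀ {n} (a : Vec ℤ n) → sumℤ a ≡ signedSum (replicate n pos) a
sumℤ≡signedSum []      = refl
sumℤ≡signedSum (x ∷ a) = cong₂ ℤ._+_ (sym (ℤ.*-identityˡ x)) (sumℤ≡signedSum a)

horner : ℤ → List ℤ → ℤ
horner W []       = 0ℤ
horner W (c ∷ cs) = c ℤ.+ W ℤ.* horner W cs

hornerVec : ∀ {n} → ℤ → List (Vec ℤ n) → Vec ℤ n
hornerVec W []       = replicate _ 0ℤ
hornerVec W (c ∷ cs) = zipWith (λ x h → x ℤ.+ W ℤ.* h) c (hornerVec W cs)

signedSum-replicate : ∀ {n} (b : Vec Sgn n) → signedSum b (replicate n 0ℤ) ≡ 0ℤ
signedSum-replicate []      = refl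
signedSum-replicate (s ∷ b) = cong₂ ℤ._+_ (ℤ.*-zeroʳ (sgnℤ s)) (signedSum-replicate b)

signedSum-zipWith : ∀ {n} W (b : Vec Sgn n) c h →
  signedSum b (zipWith (λ x y → x ℤ.+ W ℤ.* y) c h) ≡ signedSum b c ℤ.+ W ℤ.* signedSum b h
signedSum-zipWith W []      []      []      = sym (cong (λ t → 0ℤ ℤ.+ t) (ℤ.*-zeroʳ W))
signedSum-zipWith W (s ∷ b) (x ∷ c) (y ∷ h) =
  trans (cong (λ t → sgnℤ s ℤ.* (x ℤ.+ W ℤ.* y) ℤ.+ t) (signedSum-zipWith W b c h))
        (interchange (sgnℤ s) x y W (signedSum b c) (signedSum b h))
  where
  interchange : ∀ s x y W A B → s ℤ.* (x ℤ.+ W ℤ.* y) ℤ.+ (A ℤ.+ W ℤ.* B)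
                                ≡ (s ℤ.* x ℤ.+ A) ℤ.+ W ℤ.* (s ℤ.* y ℤ.+ B)
  interchange = solve-∀

signedSum-hornerVec : ∀ {n} W (b : Vec Sgn n) cs →
  signedSum b (hornerVec W cs) ≡ horner W (List.map (signedSum b) cs)
signedSum-hornerVec W b []       = signedSum-replicate b
signedSum-hornerVec W b (c ∷ cs) =
  trans (signedSum-zipWith W b c (hornerVec W cs))
        (cong (λ h → signedSum b c ℤ.+ W ℤ.* h) (signedSum-hornerVec W b cs))

digit-zero : ∀ {c w h} → ∣ c ∣ < w → c ℤ.+ + w ℤ.* h ≡ 0ℤ → c ≡ 0ℤ × h ≡ 0ℤ
digit-zero {c} {w} {h} ∣c∣<w eq = c≡0 , h≡0
  where
  c≡-wh : c ≡ - (+ w ℤ.* h)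
  c≡-wh = trans (c≡[c+x]-x c (+ w ℤ.* h)) (trans (cong (ℤ._- (+ w ℤ.* h)) eq) (ℤ.+-identityˡ _))
    where
    c≡[c+x]-x : ∀ c x → c ≡ (c ℤ.+ x) ℤ.- x
    c≡[c+x]-x = solve-∀
  ∣c∣≡w*∣h∣ : ∣ c ∣ ≡ w * ∣ h ∣
  ∣c∣≡w*∣h∣ = trans (cong ∣_∣ c≡-wh) (trans (ℤ.∣-i∣≡∣i∣ (+ w ℤ.* h)) (ℤ.abs-* (+ w) h))
  ∣h∣≡0 : ∣ h ∣ ≡ 0
  ∣h∣≡0 with ∣ h ∣ | ∣c∣≡w*∣h∣
  ... | zero  | _    = refl
  ... | suc k | ∣c∣≡ = contradiction (subst (_< w) ∣c∣≡ ∣c∣<w) (≤⇒≯ (m≤m*n w (suc k)))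
  h≡0 : h ≡ 0ℤ
  h≡0 = ℤ.∣i∣≡0⇒i≡0 ∣h∣≡0
  c≡0 : c ≡ 0ℤ
  c≡0 = trans c≡-wh (trans (cong (λ h → - (+ w ℤ.* h)) h≡0) (cong -_ (ℤ.*-zeroʳ (+ w))))

horner-digits : ∀ w cs → All (λ c → ∣ c ∣ < w) cs → horner (+ w) cs ≡ 0ℤ → All (_≡ 0ℤ) cs
horner-digits w []       []                _  = []
horner-digits w (c ∷ cs) (∣c∣<w ∷ small) eq with digit-zero ∣c∣<w eq
... | c≡0 , rest≡0 = c≡0 ∷ horner-digits w cs small rest≡0

horner-zeros : ∀ W cs → All (_≡ 0ℤ) cs → horner W cs ≡ 0ℤ
horner-zeros W []       []           = refl
horner-zeros W (c ∷ cs) (refl ∷ zs) =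
  trans (cong (λ h → 0ℤ ℤ.+ W ℤ.* h) (horner-zeros W cs zs)) (cong (λ t → 0ℤ ℤ.+ t) (ℤ.*-zeroʳ W))

signedSum-hornerVec≡0 : ∀ {n} w (b : Vec Sgn n) cs → All (λ c → sumAbs c < w) cs →
  signedSum b (hornerVec (+ w) cs) ≡ 0ℤ → All (λ c → signedSum b c ≡ 0ℤ) cs
signedSum-hornerVec≡0 w b cs small eq = map⁻ (horner-digits w _
  (map⁺ (All.map (≤-<-trans (∣signedSum∣≤sumAbs b _)) small))
  (trans (sym (signedSum-hornerVec (+ w) b cs)) eq))

_≟ˢ_ : DecidableEquality Sgn
neg ≟ˢ neg = yes refl
zer ≟ˢ zer = yes refl
pos ≟ˢ pos = yes refl
neg ≟ˢ zer = no λ ()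
neg ≟ˢ pos = no λ ()
zer ≟ˢ neg = no λ ()
zer ≟ˢ pos = no λ ()
pos ≟ˢ neg = no λ ()
pos ≟ˢ zer = no λ ()

∀-Sgn? : {P : Sgn → Set} → (∀ s → Dec (P s)) → Dec (∀ s → P s)
∀-Sgn? P? = map′ (λ (p , q , r) → λ { neg → p ; zer → q ; pos → r })
                 (λ f → f neg , f zer , f pos)
                 (P? neg ×-dec P? zer ×-dec P? pos)

∀-Vec? : ∀ n {P : Vec Sgn n → Set} → (∀ b → Dec (P b)) → Dec (∀ b → P b)
∀-Vec? zero    P? = map′ (λ p → λ { [] → p }) (λ f → f []) (P? [])
∀-Vec? (suc n) P? = map′ (λ f → λ { (s ∷ b) → f s b }) (λ f s b → f (s ∷ b))
                         (∀-Sgn? λ s → ∀-Vec? n λ b → P? (s ∷ b))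

Proper : ∀ {n} → Vec Sgn n → Set
Proper b = (∃[ i ] lookup b i ≡ zer) × (∃[ j ] lookup b j ≡ pos)

proper? : ∀ {n} (b : Vec Sgn n) → Dec (Proper b)
proper? b = any? (λ i → lookup b i ≟ˢ zer) ×-dec any? (λ j → lookup b j ≟ˢ pos)

-- The family ((w + 2)³, − w³, − 6 (w + 1)², 5, − 7)

pos-^ : ∀ m k → + (m ^ k) ≡ (+ m) ℤ.^ k
pos-^ m zero    = refl
pos-^ m (suc k) = trans (ℤ.pos-* m (m ^ k)) (cong (λ t → + m ℤ.* t) (pos-^ m k))

magnitudes : ℕ → Vec ℕ 5
magnitudes w = (2 + w) ^ 3 ∷ w ^ 3 ∷ 6 * (1 + w) ^ 2 ∷ 5 ∷ 7 ∷ []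

family : ℕ → Vec ℤ 5
family w = + ((2 + w) ^ 3) ∷ - + (w ^ 3) ∷ - + (6 * (1 + w) ^ 2) ∷ + 5 ∷ - + 7 ∷ []

-- row k lists the coefficients of wᵏ in the entries of family w
coefficients : List (Vec ℤ 5)
coefficients = (+ 8  ∷ + 0   ∷ - + 6  ∷ + 5 ∷ - + 7 ∷ [])
             ∷ (+ 12 ∷ + 0   ∷ - + 12 ∷ + 0 ∷ + 0   ∷ [])
             ∷ (+ 6  ∷ + 0   ∷ - + 6  ∷ + 0 ∷ + 0   ∷ [])
             ∷ (+ 1  ∷ - + 1 ∷ + 0    ∷ + 0 ∷ + 0   ∷ [])
             ∷ []

coefficients-small : ∀ {w} → 26 < w → All (λ c → sumAbs c < w) coefficients
coefficients-small 26<w =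
  All.map (λ ≤26 → ≤-<-trans ≤26 26<w) (from-yes (all? (λ c → sumAbs c ℕ.≤? 26) coefficients))

coefficients-vanish⇒¬proper : ∀ b → All (λ c → signedSum b c ≡ 0ℤ) coefficients → ¬ Proper b
coefficients-vanish⇒¬proper = from-yes (∀-Vec? 5 λ b →
  all? (λ c → signedSum b c ℤ.≟ 0ℤ) coefficients →-dec ¬? (proper? b))

family≡hornerVec : ∀ w → family w ≡ hornerVec (+ w) coefficients
family≡hornerVec w =
  cong₂ _∷_ (trans (pos-^ (2 + w) 3) (e₁ W))
  (cong₂ _∷_ (trans (cong -_ (pos-^ w 3)) (e₂ W))
  (cong₂ _∷_ (trans (cong -_ (trans (ℤ.pos-* 6 ((1 + w) ^ 2)) (cong (λ t → + 6 ℤ.* t) (pos-^ (1 + w) 2))))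
                    (e₃ W))
  (cong₂ _∷_ (e₄ W)
  (cong₂ _∷_ (e₅ W) refl))))
  where
  W = + w
  e₁ : ∀ W → (+ 2 ℤ.+ W) ℤ.* ((+ 2 ℤ.+ W) ℤ.* ((+ 2 ℤ.+ W) ℤ.* + 1))
           ≡ + 8 ℤ.+ W ℤ.* (+ 12 ℤ.+ W ℤ.* (+ 6 ℤ.+ W ℤ.* (+ 1 ℤ.+ W ℤ.* 0ℤ)))
  e₁ = solve-∀
  e₂ : ∀ W → - (W ℤ.* (W ℤ.* (W ℤ.* + 1)))
           ≡ + 0 ℤ.+ W ℤ.* (+ 0 ℤ.+ W ℤ.* (+ 0 ℤ.+ W ℤ.* (- + 1 ℤ.+ W ℤ.* 0ℤ)))
  e₂ = solve-∀
  e₃ : ∀ W → - (+ 6 ℤ.* ((+ 1 ℤ.+ W) ℤ.* ((+ 1 ℤ.+ W) ℤ.* + 1)))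
           ≡ - + 6 ℤ.+ W ℤ.* (- + 12 ℤ.+ W ℤ.* (- + 6 ℤ.+ W ℤ.* (+ 0 ℤ.+ W ℤ.* 0ℤ)))
  e₃ = solve-∀
  e₄ : ∀ W → + 5 ≡ + 5 ℤ.+ W ℤ.* (+ 0 ℤ.+ W ℤ.* (+ 0 ℤ.+ W ℤ.* (+ 0 ℤ.+ W ℤ.* 0ℤ)))
  e₄ = solve-∀
  e₅ : ∀ W → - + 7 ≡ - + 7 ℤ.+ W ℤ.* (+ 0 ℤ.+ W ℤ.* (+ 0 ℤ.+ W ℤ.* (+ 0 ℤ.+ W ℤ.* 0ℤ)))
  e₅ = solve-∀

abs-family : ∀ w → Vec.map ∣_∣ (family w) ≡ magnitudes w
abs-family w = cong₂ _∷_ refl (cong₂ _∷_ (ℤ.∣-i∣≡∣i∣ (+ (w ^ 3)))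
                                (cong₂ _∷_ (ℤ.∣-i∣≡∣i∣ (+ (6 * (1 + w) ^ 2))) refl))

abs-prodℤ-family : ∀ w → ∣ prodℤ (family w) ∣ ≡ product (toList (magnitudes w))
abs-prodℤ-family w = trans (abs-prodℤ (family w)) (cong (product ∘ toList) (abs-family w))

family-maxAbs : ∀ w → (2 + w) ^ 3 ≤ maxAbs (family w)
family-maxAbs w = m≤m⊔n ((2 + w) ^ 3) (maxAbs (Vec.tail (family w)))

family-sum : ∀ w → sumℤ (family w) ≡ 0ℤ
family-sum w = begin
  sumℤ (family w)                                 ≡⟨ sumℤ≡signedSum (family w) ⟩
  signedSum ones (family w)                       ≡⟨ cong (signedSum ones) (family≡hornerVec w) ⟩
  signedSum ones (hornerVec (+ w) coefficients)   ≡⟨ signedSum-hornerVec (+ w) ones coefficients ⟩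
  horner (+ w) (List.map (signedSum ones) coefficients)
    ≡⟨ horner-zeros (+ w) _ (refl ∷ refl ∷ refl ∷ refl ∷ []) ⟩
  0ℤ                                              ∎
  where
  open ≡-Reasoning
  ones = replicate 5 pos

family-proper-subsum≢0 : ∀ {w} → 26 < w → ∀ b → Proper b → signedSum b (family w) ≢ 0ℤ
family-proper-subsum≢0 {w} 26<w b proper eq =
  coefficients-vanish⇒¬proper b (signedSum-hornerVec≡0 w b coefficients (coefficients-small 26<w)
    (trans (cong (signedSum b) (sym (family≡hornerVec w))) eq)) proper

magnitudes-coprime : ∀ {w} → Coprime w 210 → Coprime (2 + w) 210 → Coprime (1 + w) 35 →
                     AllPairs Coprime (magnitudes w)
magnitudes-coprime {w} w⊥210 y⊥210 x⊥35 =
    (coprime-^ˡ 3 (coprime-^ʳ 3 y⊥w) VecAll.∷ coprime-to-rest y⊥210 y⊥x)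
  ∷ coprime-to-rest w⊥210 (Coprime.sym x⊥w)
  ∷ (Coprime.sym (coprime-∣ˡ (from-yes (5 ∣? 35)) 35⊥c)
       VecAll.∷ Coprime.sym (coprime-∣ˡ (from-yes (7 ∣? 35)) 35⊥c) VecAll.∷ VecAll.[])
  ∷ (from-yes (coprime? 5 7) VecAll.∷ VecAll.[])
  ∷ VecAll.[]
  ∷ []
  where
  x = 1 + w
  y⊥w : Coprime (2 + w) w
  y⊥w = coprime-+ˡ (Coprime.sym (coprime-∣ʳ (from-yes (2 ∣? 210)) w⊥210))
  y⊥x : Coprime (2 + w) x
  y⊥x = coprime-+ˡ (1-coprimeTo x)
  x⊥w : Coprime x w
  x⊥w = coprime-+ˡ (1-coprimeTo w)
  35⊥c : Coprime 35 (6 * x ^ 2)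
  35⊥c = coprime-*ʳ (from-yes (coprime? 35 6)) (coprime-^ʳ 2 (Coprime.sym x⊥35))
  coprime-to-rest : ∀ {n} → Coprime n 210 → Coprime n x →
                    VecAll.All (Coprime (n ^ 3)) (6 * x ^ 2 ∷ 5 ∷ 7 ∷ [])
  coprime-to-rest {n} n⊥210 n⊥x =
             coprime-∣ʳ (*-monoˡ-∣ (x ^ 2) (from-yes (6 ∣? 210))) c
    VecAll.∷ coprime-∣ʳ (∣m⇒∣m*n (x ^ 2) (from-yes (5 ∣? 210))) c
    VecAll.∷ coprime-∣ʳ (∣m⇒∣m*n (x ^ 2) (from-yes (7 ∣? 210))) c
    VecAll.∷ VecAll.[]
    where
    c : Coprime (n ^ 3) (210 * x ^ 2)
    c = coprime-^ˡ 3 (coprime-*ʳ n⊥210 (coprime-^ʳ 2 n⊥x))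

family∈U : ∀ {w} → Coprime w 210 → Coprime (2 + w) 210 → DividesPowerOf 6 (1 + w) → 26 < w →
           InU5 (family w)
family∈U {w} w⊥210 y⊥210 (k , x∣6ᵏ) 26<w =
    gcd≡1 (family w) (subst (AllPairs Coprime) (sym (abs-family w)) (magnitudes-coprime w⊥210 y⊥210 x⊥35))
  , family-sum w
  , λ (b , has-zer , has-pos , eq) → family-proper-subsum≢0 26<w b (has-zer , has-pos) eq
  where
  x⊥35 : Coprime (1 + w) 35
  x⊥35 = coprime-∣ˡ x∣6ᵏ (coprime-^ˡ k (from-yes (coprime? 6 35)))

magnitudes-nonZero : ∀ w .{{_ : NonZero w}} → NonZero (product (toList (magnitudes w)))
magnitudes-nonZero w = product≢0 {ns = toList (magnitudes w)}
  (m^n≢0 (2 + w) 3 ∷ m^n≢0 w 3 ∷ m*n≢0 6 ((1 + w) ^ 2) {{_}} {{m^n≢0 (1 + w) 2}} ∷ _ ∷ _ ∷ [])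

magnitudes-dividePowerOf : ∀ w → DividesPowerOf 6 (1 + w) →
                           DividesPowerOf ((2 + w) * w * 210) (product (toList (magnitudes w)))
magnitudes-dividePowerOf w x-dpo = dividesPowerOf-product {ns = toList (magnitudes w)}
  ( dividesPowerOf-^ 3 y∣R
  ∷ dividesPowerOf-^ 3 w∣R
  ∷ dividesPowerOf-* 6∣R (dividesPowerOf-^ 2 (dividesPowerOf-trans x-dpo 6∣R))
  ∷ ∣R (from-yes (5 ∣? 210))
  ∷ ∣R (from-yes (7 ∣? 210))
  ∷ [])
  where
  R = (2 + w) * w * 210
  y∣R : DividesPowerOf R (2 + w)
  y∣R = ∣⇒dividesPowerOf (∣m⇒∣m*n 210 (m∣m*n w))
  w∣R : DividesPowerOf R w
  w∣R = ∣⇒dividesPowerOf (∣m⇒∣m*n 210 (n∣m*n (2 + w)))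
  ∣R : ∀ {d} → d ∣ 210 → DividesPowerOf R d
  ∣R d∣210 = ∣⇒dividesPowerOf (∣n⇒∣m*n ((2 + w) * w) d∣210)
  6∣R : DividesPowerOf R 6
  6∣R = ∣R (from-yes (6 ∣? 210))

family-quality : ∀ w u v .{{_ : NonZero w}} → DividesPowerOf 6 (1 + w) → 210 ^ u ≤ 2 + w →
                 2 * u < 3 * v → QualityAtLeast (family w) u v
family-quality w u v x-dpo 210ᵘ≤y 2u<3v
  with rad-exists ∣ prodℤ (family w) ∣ {{subst NonZero (sym (abs-prodℤ-family w)) (magnitudes-nonZero w)}}
... | r , rad = r , rad , (begin
  r ^ u                 ≤⟨ quality-bound {r} {210} {y} {u} {v} r≤y²210 210ᵘ≤y 2u<3v ⟩
  (y ^ 3) ^ v           ≤⟨ ^-monoˡ-≤ v (family-maxAbs w) ⟩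
  maxAbs (family w) ^ v ∎)
  where
  open ≤-Reasoning
  y = 2 + w
  r≤y²210 : r ≤ y ^ 2 * 210
  r≤y²210 = begin
    r           ≤⟨ rad≤ {{m*n≢0 (y * w) 210 {{m*n≢0 y w}}}} rad
                    (subst (DividesPowerOf _) (sym (abs-prodℤ-family w)) (magnitudes-dividePowerOf w x-dpo)) ⟩
    y * w * 210 ≤⟨ *-monoˡ-≤ 210 (*-monoʳ-≤ y (≤-trans (m≤n+m w 2) (≤-reflexive (sym (*-identityʳ y))))) ⟩
    y ^ 2 * 210 ∎

-- Choice of w

n<m^n : 1 < m → ∀ n → n < m ^ n
n<m^n {m@(suc _)} _   zero    = m^n>0 m 0
n<m^n             1<m (suc n) = ≤-<-trans (n<m^n 1<m n) (^-monoʳ-< _ 1<m (n<1+n n))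

12*4096^m≡12+p*210 : ∀ m → ∃[ p ] 12 * 4096 ^ m ≡ 12 + p * 210
12*4096^m≡12+p*210 zero    = 0 , refl
12*4096^m≡12+p*210 (suc m) with 12*4096^m≡12+p*210 m
... | p , eq = 234 + 4096 * p , (begin
  12 * (4096 * 4096 ^ m) ≡⟨ *-comm-left 12 4096 (4096 ^ m) ⟩
  4096 * (12 * 4096 ^ m) ≡⟨ cong (4096 *_) eq ⟩
  4096 * (12 + p * 210)  ≡⟨ expand p ⟩
  12 + (234 + 4096 * p) * 210 ∎)
  where
  open ≡-Reasoning
  *-comm-left : ∀ a b c → a * (b * c) ≡ b * (a * c)
  *-comm-left = ℕ-Solver.solve-∀
  expand : ∀ p → 4096 * (12 + p * 210) ≡ 12 + (234 + 4096 * p) * 210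
  expand = ℕ-Solver.solve-∀

record Parameter (B : ℕ) : Set where
  field
    w     : ℕ
    B≤w   : B ≤ w
    w⊥210 : Coprime w 210
    y⊥210 : Coprime (2 + w) 210
    x-dpo : DividesPowerOf 6 (1 + w)

parameter-choice : ∀ B → Parameter B
parameter-choice B with 12*4096^m≡12+p*210 B
... | p , eq = record
  { w     = 11 + p * 210
  ; B≤w   = ≤-pred (begin-strict
      B              <⟨ n<m^n (s≤s (s≤s z≤n)) B ⟩
      4096 ^ B       ≤⟨ m≤n*m (4096 ^ B) 12 ⟩
      12 * 4096 ^ B  ≡⟨ eq ⟩
      12 + p * 210   ∎)
  ; w⊥210 = coprime-+-* p (from-yes (coprime? 11 210))
  ; y⊥210 = coprime-+-* p (from-yes (coprime? 13 210))
  ; x-dpo = subst (DividesPowerOf 6) eq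
      (dividesPowerOf-* (2 , from-yes (12 ∣? 6 ^ 2)) (dividesPowerOf-^ B (12 , from-yes (4096 ∣? 6 ^ 12))))
  }
  where open ≤-Reasoning

large⇒∉ : {A : Set} (f : A → ℕ) (S : List A) → ∃[ L ] (∀ {a} → L < f a → a ∉ S)
large⇒∉ f [] = 0 , λ _ ()
large⇒∉ f (b ∷ S) with large⇒∉ f S
... | L , ∉S = f b ⊔ L , λ where
  fb⊔L<fa (here refl) → <-irrefl refl (m⊔n<o⇒m<o _ _ fb⊔L<fa)
  fb⊔L<fa (there a∈S) → ∉S (m⊔n<o⇒n<o _ _ fb⊔L<fa) a∈S

theorem2p1 : (u v : ℕ) → 0 < v → 2 * u < 3 * v → (S : List (Vec ℤ 5)) →
    Σ (Vec ℤ 5) (λ a → InU5 a × a ∉ S × QualityAtLeast a u v)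
theorem2p1 u v _ 2u<3v S with large⇒∉ maxAbs S
... | L , large⇒∉S = witness (parameter-choice (27 + L + 210 ^ u))
  where
  -- matching on an arbitrary Parameter keeps the concrete w of parameter-choice from being unfolded
  witness : Parameter (27 + L + 210 ^ u) → Σ (Vec ℤ 5) (λ a → InU5 a × a ∉ S × QualityAtLeast a u v)
  witness record { w = w ; B≤w = B≤w ; w⊥210 = w⊥210 ; y⊥210 = y⊥210 ; x-dpo = x-dpo } =
    family w , family∈U w⊥210 y⊥210 x-dpo 26<w , large⇒∉S L<maxAbs ,
    family-quality w u v {{>-nonZero (≤-trans (s≤s z≤n) 26<w)}} x-dpo 210ᵘ≤y 2u<3v
    where
    open ≤-Reasoning
    26<w : 26 < w
    26<w = ≤-trans (≤-trans (m≤m+n 27 L) (m≤m+n (27 + L) (210 ^ u))) B≤w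
    L<maxAbs : L < maxAbs (family w)
    L<maxAbs = begin-strict
      L                 ≤⟨ ≤-trans (≤-trans (m≤n+m L 27) (m≤m+n (27 + L) (210 ^ u))) B≤w ⟩
      w                 <⟨ m<n+m w (s≤s z≤n) ⟩
      2 + w             ≤⟨ m≤m*n (2 + w) ((2 + w) ^ 2) ⟩
      (2 + w) ^ 3       ≤⟨ family-maxAbs w ⟩
      maxAbs (family w) ∎
    210ᵘ≤y : 210 ^ u ≤ 2 + w
    210ᵘ≤y = ≤-trans (m≤n+m (210 ^ u) (27 + L)) (≤-trans B≤w (m≤n+m w 2))
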